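{- For every cyclic formula $\phi$: (i) if $\mathsf{CHL}\vdash\Box\phi$ then $\mathsf{CHL}\vdash\Box^\bullet\phi$; (ii) if $\mathsf{CHL}\vdash\phi$ then $\mathsf{CHL}\vdash\Box^\bullet\phi$; (iii) if $\mathsf{CHL}\vdash\Box^\bullet\phi\to\phi$ then $\mathsf{CHL}\vdash\phi$.
   Context: Labels: $\bot,\top$ and propositional variables (arity 0), $\neg,\Box$ (arity 1), $\wedge,\vee,\to$ (arity 2). A graph is $\langle V,r,S,\lambda\rangle$ with $V$ finite, root $r$, labelling $\lambda$, $S:V\to V^{*}$ ordered successors (length = arity of label); every vertex reachable from $r$. A (cyclic) formula is a graph in which every cycle (closed path of pairwise distinct vertices along successors) contains a $\Box$-labelled vertex. Bisimulation: $aRa'$ implies equal labels and $i$-th successors related; $\simeq$ = bisimilarity relating roots. $\phi$ modalised in $p$: every path from root to a $p$-labelled vertex contains a $\Box$-labelled vertex; then $\digamma p.\phi$ identifies the root with all $p$-labelled vertices (keeping the root's label). $\mathsf{CHL}$: least set of cyclic formulas containing all substitution instances of propositional tautologies, all $\Box(\phi\to\psi)\to(\Box\phi\to\Box\psi)$, all $\phi\leftrightarrow\psi$ with $\phi\simeq\psi$, closed under modus ponens, necessitation and Löb's rule (from $\vdash\Box\phi\to\phi$ infer $\vdash\phi$). $\Box^\bullet\phi:=\digamma p.\Box(\phi\wedge p)$ with $p$ not occurring in $\phi$. -}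

module Defs where

open import Data.Nat using (ℕ; zero; suc; _+_; _≡ᵇ_)
open import Data.Fin using (Fin; zero; suc; _↑ˡ_; _↑ʳ_; splitAt)
open import Data.Bool using (Bool; true; false; T; _∧_; not; if_then_else_)
open import Data.Sum using ([_,_]′)
open import Data.Product using (Σ; _×_; _,_)
open import Data.List using (List; []; _∷_; _++_; [_]; map; length)
open import Data.List.Membership.Propositional using (_∈_)
open import Data.List.Relation.Unary.All using (All)
open import Data.List.Relation.Unary.Any using (Any)
open import Data.List.Relation.Unary.Linked using (Linked)
open import Data.List.Relation.Unary.Unique.Propositional using (Unique)
open import Data.List.Relation.Binary.Pointwise using (Pointwise)
open import Relation.Binary.PropositionalEquality using (_≡_; _≢_)
open import Level using (0ℓ) renaming (suc to lsuc)

data Label : Set where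
  ⊥ᴸ ⊤ᴸ : Label
  var   : ℕ → Label
  ¬ᴸ □ᴸ : Label
  ∧ᴸ ∨ᴸ →ᴸ : Label

arity : Label → ℕ
arity ⊥ᴸ      = 0
arity ⊤ᴸ      = 0
arity (var _) = 0
arity ¬ᴸ      = 1
arity □ᴸ      = 1
arity ∧ᴸ      = 2
arity ∨ᴸ      = 2
arity →ᴸ      = 2

isVar : ℕ → Label → Bool
isVar p (var q) = p ≡ᵇ q
isVar p _       = false

-- Raw graphs.  The (finite) vertex set is the subset
--   { v : Fin size | T (vtx v) }   of Fin size.
-- lab / succ on non-vertices are irrelevant junk.

record Graph : Set where
  field
    size : ℕ
    vtx  : Fin size → Bool
    root : Fin size
    lab  : Fin size → Label
    succ : Fin size → List (Fin size)
open Graph public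

Vert : (G : Graph) → Fin (size G) → Set
Vert G v = T (vtx G v)

Edge : (G : Graph) → Fin (size G) → Fin (size G) → Set
Edge G u w = w ∈ succ G u

data Walk (G : Graph) : Fin (size G) → Fin (size G) → List (Fin (size G)) → Set where
  here : ∀ {v} → Walk G v v (v ∷ [])
  step : ∀ {u v w vs} → Edge G u v → Walk G v w vs → Walk G u w (u ∷ vs)

Reachable : (G : Graph) → Fin (size G) → Set
Reachable G v = Σ (List (Fin (size G))) (λ vs → Walk G (root G) v vs)

IsGraph : Graph → Set
IsGraph G =
  Vert G (root G) ×
  (∀ v → Vert G v → length (succ G v) ≡ arity (lab G v)) ×
  (∀ v → Vert G v → All (Vert G) (succ G v)) ×
  (∀ v → Vert G v → Reachable G v)

IsCycle : (G : Graph) → List (Fin (size G)) → Set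
IsCycle G []       = Data.Empty.⊥ where import Data.Empty
IsCycle G (x ∷ xs) =
  All (Vert G) (x ∷ xs) × Unique (x ∷ xs) × Linked (Edge G) (x ∷ xs ++ [ x ])

IsFormula : Graph → Set
IsFormula G = IsGraph G ×
  (∀ cs → IsCycle G cs → Any (λ v → lab G v ≡ □ᴸ) cs)

Fresh : ℕ → Graph → Set
Fresh p G = ∀ v → Vert G v → lab G v ≢ var p

Modalised : ℕ → Graph → Set
Modalised p G = ∀ w vs → Walk G (root G) w vs → lab G w ≡ var p →
  Any (λ v → lab G v ≡ □ᴸ) vs

IsBisimulation : (G H : Graph) → (Fin (size G) → Fin (size H) → Set) → Set
IsBisimulation G H R = ∀ a b → R a b →
  (lab G a ≡ lab H b) × Pointwise R (succ G a) (succ H b)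

_≃_ : Graph → Graph → Set₁
G ≃ H = Σ (Fin (size G) → Fin (size H) → Set) λ R →
  IsBisimulation G H R × R (root G) (root H)

leaf : Label → Graph
leaf l = record { size = 1 ; vtx = λ _ → true ; root = zero
                ; lab = λ _ → l ; succ = λ _ → [] }

node1 : Label → Graph → Graph
node1 l G = record { size = suc (size G) ; vtx = V ; root = zero ; lab = L ; succ = S }
  where
  V : Fin (suc (size G)) → Bool
  V zero    = true
  V (suc i) = vtx G i
  L : Fin (suc (size G)) → Label
  L zero    = l
  L (suc i) = lab G i
  S : Fin (suc (size G)) → List (Fin (suc (size G)))
  S zero    = suc (root G) ∷ []
  S (suc i) = map suc (succ G i)

node2 : Label → Graph → Graph → Graph
node2 l G H = record { size = suc (n + m) ; vtx = V ; root = zero ; lab = L ; succ = S }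
  where
  n = size G
  m = size H
  inl : Fin n → Fin (suc (n + m))
  inl i = suc (i ↑ˡ m)
  inr : Fin m → Fin (suc (n + m))
  inr j = suc (n ↑ʳ j)
  V : Fin (suc (n + m)) → Bool
  V zero    = true
  V (suc i) = [ vtx G , vtx H ]′ (splitAt n i)
  L : Fin (suc (n + m)) → Label
  L zero    = l
  L (suc i) = [ lab G , lab H ]′ (splitAt n i)
  S : Fin (suc (n + m)) → List (Fin (suc (n + m)))
  S zero    = inl (root G) ∷ inr (root H) ∷ []
  S (suc i) = [ (λ j → map inl (succ G j)) , (λ k → map inr (succ H k)) ]′ (splitAt n i)

⊥ᶠ ⊤ᶠ : Graph
⊥ᶠ = leaf ⊥ᴸ
⊤ᶠ = leaf ⊤ᴸ

varᶠ : ℕ → Graph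
varᶠ p = leaf (var p)

¬ᶠ_ □_ : Graph → Graph
¬ᶠ G = node1 ¬ᴸ G
□ G  = node1 □ᴸ G

_∧ᶠ_ _∨ᶠ_ _⇒_ _⇔_ : Graph → Graph → Graph
G ∧ᶠ H = node2 ∧ᴸ G H
G ∨ᶠ H = node2 ∨ᴸ G H
G ⇒ H  = node2 →ᴸ G H
G ⇔ H  = (G ⇒ H) ∧ᶠ (H ⇒ G)

infixr 6 _∧ᶠ_ _∨ᶠ_
infixr 5 _⇒_ _⇔_

-- G : identify the root with all p-labelled vertices, keeping the
-- root's label.

ϝ : ℕ → Graph → Graph
ϝ p G = record { size = size G
               ; vtx  = λ v → vtx G v ∧ not (isVar p (lab G v))
               ; root = root G
               ; lab  = lab G
               ; succ = λ v → map redirect (succ G v) }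
  where
  redirect : Fin (size G) → Fin (size G)
  redirect w = if isVar p (lab G w) then root G else w

-- □• φ := ϝ p . □ (φ ∧ p)   (p to be chosen not occurring in φ)
□•[_]_ : ℕ → Graph → Graph
□•[ p ] φ = ϝ p (□ (φ ∧ᶠ varᶠ p))

data PForm : Set where
  pvar : ℕ → PForm
  p⊥ p⊤ : PForm
  p¬ : PForm → PForm
  _p∧_ _p∨_ _p→_ : PForm → PForm → PForm

eval : (ℕ → Bool) → PForm → Bool
eval ρ (pvar i)  = ρ i
eval ρ p⊥        = false
eval ρ p⊤        = true
eval ρ (p¬ a)    = not (eval ρ a)
eval ρ (a p∧ b)  = eval ρ a ∧ eval ρ b
eval ρ (a p∨ b)  = eval ρ a Data.Bool.∨ eval ρ b
eval ρ (a p→ b)  = not (eval ρ a) Data.Bool.∨ eval ρ b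

Tautology : PForm → Set
Tautology τ = ∀ (ρ : ℕ → Bool) → eval ρ τ ≡ true

inst : (ℕ → Graph) → PForm → Graph
inst σ (pvar i) = σ i
inst σ p⊥       = ⊥ᶠ
inst σ p⊤       = ⊤ᶠ
inst σ (p¬ a)   = ¬ᶠ inst σ a
inst σ (a p∧ b) = inst σ a ∧ᶠ inst σ b
inst σ (a p∨ b) = inst σ a ∨ᶠ inst σ b
inst σ (a p→ b) = inst σ a ⇒ inst σ b

infix 2 CHL⊢_
data CHL⊢_ : Graph → Set₁ where
  taut : ∀ τ (σ : ℕ → Graph) → Tautology τ → IsFormula (inst σ τ) →
         CHL⊢ inst σ τ
  K    : ∀ {φ ψ} → IsFormula φ → IsFormula ψ →
         CHL⊢ □ (φ ⇒ ψ) ⇒ (□ φ ⇒ □ ψ)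
  bis  : ∀ {φ ψ} → IsFormula φ → IsFormula ψ → φ ≃ ψ → CHL⊢ φ ⇔ ψ
  mp   : ∀ {φ ψ} → CHL⊢ φ → CHL⊢ φ ⇒ ψ → CHL⊢ ψ
  nec  : ∀ {φ} → CHL⊢ φ → CHL⊢ □ φ
  löb  : ∀ {φ} → CHL⊢ □ φ ⇒ φ → CHL⊢ φ

{-# OPTIONS --safe #-}
-- Identifying the p-leaf of □ (φ ∧ p) with the root makes the inner occurrence of p
-- point back to the whole graph, so □•φ is bisimilar to its unfolding □ (φ ∧ □•φ) and
-- CHL ⊢ □•φ ↔ □ (φ ∧ □•φ).  Hence from ⊢ □ (□•φ → φ ∧ □•φ) we get ⊢ □□•φ → □•φ by K,
-- and Löb's rule gives ⊢ □•φ.  In (i) that premise comes from ⊢ □ φ by K, in (iii) from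
-- ⊢ □•φ → φ by necessitation, and (ii) is (i) after necessitation.  Most of the work is
-- checking that all graphs involved are cyclic formulas: a cycle of ϝ p A either passes
-- through its □-labelled root or is already a cycle of A.
module Submission where

open import Defs
open import Data.Nat using (ℕ; zero; suc; _+_)
open import Data.Nat.Properties using (≡ᵇ⇒≡; ≡⇒≡ᵇ)
open import Data.Fin using (Fin; zero; suc; _↑ˡ_; _↑ʳ_; splitAt)
open import Data.Fin.Properties
  using (suc-injective; ↑ˡ-injective; ↑ʳ-injective; splitAt-↑ˡ; splitAt-↑ʳ; splitAt⁻¹-↑ˡ; splitAt⁻¹-↑ʳ)
  renaming (_≟_ to _≟ᶠ_)
open import Data.Bool using (true; false; T; if_then_else_)
open import Data.Bool.Properties using (T-≡; T-∧; T-not-≡)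
open import Data.Sum using (_⊎_; inj₁; inj₂; [_,_]′)
open import Data.Product using (∃; _×_; _,_; proj₁; proj₂)
open import Data.Unit using (tt)
open import Data.Empty using (⊥-elim)
open import Data.List using (List; []; _∷_; _++_; [_]; map; length)
open import Data.List.Properties using (length-map; map-++; map-∘; map-id)
open import Data.List.Membership.Propositional using (_∈_)
open import Data.List.Membership.Propositional.Properties using (∈-map⁺; ∈-map⁻)
open import Data.List.Relation.Unary.All as All using (All; []; _∷_)
import Data.List.Relation.Unary.All.Properties as AllP
open import Data.List.Relation.Unary.Any as Any using (Any; here; there)
import Data.List.Relation.Unary.Any.Properties as AnyP
open import Data.List.Relation.Unary.Linked as Linked using (Linked; [-]; _∷_)
import Data.List.Relation.Unary.Linked.Properties as LinkedP
import Data.List.Relation.Unary.Unique.Propositional.Properties as UniqueP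
open import Data.List.Relation.Binary.Pointwise using (Pointwise; []; _∷_)
open import Function using (_∘_; id)
open import Function.Bundles using (Equivalence)
open import Relation.Binary.PropositionalEquality using (_≡_; _≢_; refl; sym; trans; cong; subst; module ≡-Reasoning)
open import Relation.Nullary using (¬_; yes; no)

open Equivalence using (to; from)

isVar-var : ∀ p → isVar p (var p) ≡ true
isVar-var p = to T-≡ (≡⇒≡ᵇ p p refl)

isVar⇒≡var : ∀ {p} l → isVar p l ≡ true → l ≡ var p
isVar⇒≡var {p} (var q) eq = cong var (sym (≡ᵇ⇒≡ p q (from T-≡ eq)))
isVar⇒≡var ⊥ᴸ ()
isVar⇒≡var ⊤ᴸ ()
isVar⇒≡var ¬ᴸ ()
isVar⇒≡var □ᴸ ()
isVar⇒≡var ∧ᴸ ()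
isVar⇒≡var ∨ᴸ ()
isVar⇒≡var →ᴸ ()

≢var⇒isVar≡false : ∀ {p} l → l ≢ var p → isVar p l ≡ false
≢var⇒isVar≡false {p} l l≢p with isVar p l in eq
... | true  = ⊥-elim (l≢p (isVar⇒≡var l eq))
... | false = refl

length≡0⇒∉ : ∀ {A : Set} {x : A} xs → length xs ≡ 0 → ¬ x ∈ xs
length≡0⇒∉ [] _ ()

Linked-into-last : ∀ {A : Set} {R : A → A → Set} x xs y → Linked R (x ∷ xs ++ [ y ]) → ∃ λ u → R u y
Linked-into-last x []       y (r ∷ [-]) = x , r
Linked-into-last x (z ∷ zs) y (_ ∷ rs)  = Linked-into-last z zs y rs

All⇒Pointwise-map : ∀ {A B C : Set} {P : A → Set} {R : B → C → Set} {f : A → B} {g : A → C} →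
  (∀ {x} → P x → R (f x) (g x)) → ∀ {xs} → All P xs → Pointwise R (map f xs) (map g xs)
All⇒Pointwise-map r []         = []
All⇒Pointwise-map r (px ∷ pxs) = r px ∷ All⇒Pointwise-map r pxs

Boxed : (G : Graph) → Fin (size G) → Set
Boxed G v = lab G v ≡ □ᴸ

Guarded : Graph → Set
Guarded G = ∀ cs → IsCycle G cs → Any (Boxed G) cs

module _ {G : Graph} (g : IsGraph G) where

  root-isVert : Vert G (root G)
  root-isVert = proj₁ g

  succ-length : ∀ v → Vert G v → length (succ G v) ≡ arity (lab G v)
  succ-length = proj₁ (proj₂ g)

  succ-isVert : ∀ v → Vert G v → All (Vert G) (succ G v)
  succ-isVert = proj₁ (proj₂ (proj₂ g))

  reachable : ∀ v → Vert G v → Reachable G v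
  reachable = proj₂ (proj₂ (proj₂ g))

unentered-∉-cycle : ∀ {G v xs} → (∀ u → ¬ Edge G u v) → ¬ IsCycle G (v ∷ xs)
unentered-∉-cycle {v = v} {xs} unentered (_ , _ , linked) with Linked-into-last v xs v linked
... | u , e = unentered u e

record Embedding (G H : Graph) : Set where
  field
    embed      : Fin (size G) → Fin (size H)
    injective  : ∀ {a b} → embed a ≡ embed b → a ≡ b
    lab-embed  : ∀ u → lab H (embed u) ≡ lab G u
    vtx-embed  : ∀ u → vtx H (embed u) ≡ vtx G u
    succ-embed : ∀ u → succ H (embed u) ≡ map embed (succ G u)

_∘ᴱ_ : ∀ {F G H} → Embedding G H → Embedding F G → Embedding F H
_∘ᴱ_ {F} {G} {H} e f = record
  { embed      = e.embed ∘ f.embed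
  ; injective  = f.injective ∘ e.injective
  ; lab-embed  = λ u → trans (e.lab-embed (f.embed u)) (f.lab-embed u)
  ; vtx-embed  = λ u → trans (e.vtx-embed (f.embed u)) (f.vtx-embed u)
  ; succ-embed = succ-embed
  }
  where
  module e = Embedding e
  module f = Embedding f
  open ≡-Reasoning
  succ-embed : ∀ u → succ H (e.embed (f.embed u)) ≡ map (e.embed ∘ f.embed) (succ F u)
  succ-embed u = begin
    succ H (e.embed (f.embed u))           ≡⟨ e.succ-embed (f.embed u) ⟩
    map e.embed (succ G (f.embed u))       ≡⟨ cong (map e.embed) (f.succ-embed u) ⟩
    map e.embed (map f.embed (succ F u))   ≡⟨ map-∘ (succ F u) ⟨
    map (e.embed ∘ f.embed) (succ F u)     ∎

module Embedded {G H : Graph} (e : Embedding G H) where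
  open Embedding e

  vert⁺ : ∀ {u} → Vert G u → Vert H (embed u)
  vert⁺ {u} = subst T (sym (vtx-embed u))

  vert⁻ : ∀ {u} → Vert H (embed u) → Vert G u
  vert⁻ {u} = subst T (vtx-embed u)

  edge⁺ : ∀ {a b} → Edge G a b → Edge H (embed a) (embed b)
  edge⁺ {a} ab = subst (_ ∈_) (sym (succ-embed a)) (∈-map⁺ embed ab)

  edge⁻ : ∀ {a b} → Edge H (embed a) (embed b) → Edge G a b
  edge⁻ {a} ab with ∈-map⁻ embed (subst (_ ∈_) (succ-embed a) ab)
  ... | w , w∈ , eq = subst (_∈ succ G a) (sym (injective eq)) w∈

  edge-from-image : ∀ {u v} → Edge H (embed u) v → ∃ λ w → v ≡ embed w
  edge-from-image {u} uv with ∈-map⁻ embed (subst (_ ∈_) (succ-embed u) uv)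
  ... | w , _ , eq = w , eq

  walk⁺ : ∀ {a b vs} → Walk G a b vs → Walk H (embed a) (embed b) (map embed vs)
  walk⁺ here        = here
  walk⁺ (step ab w) = step (edge⁺ ab) (walk⁺ w)

  succ-length⁺ : ∀ {u} → length (succ G u) ≡ arity (lab G u) →
    length (succ H (embed u)) ≡ arity (lab H (embed u))
  succ-length⁺ {u} len rewrite succ-embed u | lab-embed u | length-map embed (succ G u) = len

  succ-isVert⁺ : ∀ {u} → All (Vert G) (succ G u) → All (Vert H) (succ H (embed u))
  succ-isVert⁺ {u} vs rewrite succ-embed u = AllP.map⁺ (All.map vert⁺ vs)

  reachable⁺ : Edge H (root H) (embed (root G)) → ∀ {u} → Reachable G u → Reachable H (embed u)
  reachable⁺ r (vs , w) = root H ∷ map embed vs , step r (walk⁺ w)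

  path-from-image : ∀ y xs zs → Linked (Edge H) (embed y ∷ xs ++ zs) → ∃ λ ys → xs ≡ map embed ys
  path-from-image y []       zs _ = [] , refl
  path-from-image y (x ∷ xs) zs (yx ∷ linked) with edge-from-image yx
  ... | w , refl with path-from-image w xs zs linked
  ...   | ys , refl = w ∷ ys , refl

  cycle⁻ : ∀ ys → IsCycle H (map embed ys) → IsCycle G ys
  cycle⁻ (y ∷ ys) (vs , unique , linked) =
    All.map vert⁻ (AllP.map⁻ vs) ,
    UniqueP.map⁻ unique ,
    Linked.map edge⁻ (LinkedP.map⁻ (subst (Linked (Edge H)) (sym (map-++ embed (y ∷ ys) [ y ])) linked))

  guarded-through-image : Guarded G → ∀ y xs → IsCycle H (embed y ∷ xs) → Any (Boxed H) (embed y ∷ xs)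
  guarded-through-image guarded y xs cycle with path-from-image y xs [ embed y ] (proj₂ (proj₂ cycle))
  ... | ys , refl =
    AnyP.map⁺ (Any.map (λ {u} boxed → trans (lab-embed u) boxed) (guarded (y ∷ ys) (cycle⁻ (y ∷ ys) cycle)))

node1-embedding : ∀ l G → Embedding G (node1 l G)
node1-embedding l G = record
  { embed = suc ; injective = suc-injective
  ; lab-embed = λ _ → refl ; vtx-embed = λ _ → refl ; succ-embed = λ _ → refl }

node2-left : ∀ l G H → Embedding G (node2 l G H)
node2-left l G H = record
  { embed      = λ i → suc (i ↑ˡ size H)
  ; injective  = λ {a} {b} eq → ↑ˡ-injective (size H) a b (suc-injective eq)
  ; lab-embed  = λ u → cong [ lab G , lab H ]′ (splitAt-↑ˡ (size G) u (size H))
  ; vtx-embed  = λ u → cong [ vtx G , vtx H ]′ (splitAt-↑ˡ (size G) u (size H))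
  ; succ-embed = λ u → cong [ _ , _ ]′ (splitAt-↑ˡ (size G) u (size H))
  }

node2-right : ∀ l G H → Embedding H (node2 l G H)
node2-right l G H = record
  { embed      = λ j → suc (size G ↑ʳ j)
  ; injective  = λ {a} {b} eq → ↑ʳ-injective (size G) a b (suc-injective eq)
  ; lab-embed  = λ u → cong [ lab G , lab H ]′ (splitAt-↑ʳ (size G) (size H) u)
  ; vtx-embed  = λ u → cong [ vtx G , vtx H ]′ (splitAt-↑ʳ (size G) (size H) u)
  ; succ-embed = λ u → cong [ _ , _ ]′ (splitAt-↑ʳ (size G) (size H) u)
  }

data Node2View (n m : ℕ) : Fin (suc (n + m)) → Set where
  at-root  : Node2View n m zero
  in-left  : (i : Fin n) → Node2View n m (suc (i ↑ˡ m))
  in-right : (j : Fin m) → Node2View n m (suc (n ↑ʳ j))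

node2-view : ∀ n m v → Node2View n m v
node2-view n m zero = at-root
node2-view n m (suc k) with splitAt n k in eq
... | inj₁ i = subst (Node2View n m ∘ suc) (splitAt⁻¹-↑ˡ eq) (in-left i)
... | inj₂ j = subst (Node2View n m ∘ suc) (splitAt⁻¹-↑ʳ eq) (in-right j)

leaf-isFormula : ∀ {l} → arity l ≡ 0 → IsFormula (leaf l)
leaf-isFormula {l} arity≡0 = (tt , (λ _ _ → sym arity≡0) , (λ _ _ → []) , reach) , guarded
  where
  reach : ∀ v → Vert (leaf l) v → Reachable (leaf l) v
  reach zero _ = _ , here
  guarded : Guarded (leaf l)
  guarded (x ∷ xs) cycle = ⊥-elim (unentered-∉-cycle {leaf l} (λ _ ()) cycle)

node1-isFormula : ∀ {l G} → arity l ≡ 1 → IsFormula G → IsFormula (node1 l G)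
node1-isFormula {l} {G} arity≡1 (g , G-guarded) = (tt , len , vs , reach) , guarded
  where
  N = node1 l G
  open Embedded (node1-embedding l G)
  len : ∀ v → Vert N v → length (succ N v) ≡ arity (lab N v)
  len zero    _  = sym arity≡1
  len (suc u) vu = succ-length⁺ (succ-length g u (vert⁻ vu))
  vs : ∀ v → Vert N v → All (Vert N) (succ N v)
  vs zero    _  = root-isVert g ∷ []
  vs (suc u) vu = succ-isVert⁺ (succ-isVert g u (vert⁻ vu))
  reach : ∀ v → Vert N v → Reachable N v
  reach zero    _  = _ , here
  reach (suc u) vu = reachable⁺ (here refl) (reachable g u (vert⁻ vu))
  unentered : ∀ u → ¬ Edge N u zero
  unentered zero (here ())
  unentered (suc u) e with edge-from-image e
  ... | _ , ()
  guarded : Guarded N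
  guarded (zero  ∷ xs) cycle = ⊥-elim (unentered-∉-cycle {N} unentered cycle)
  guarded (suc y ∷ xs) cycle = guarded-through-image G-guarded y xs cycle

node2-isFormula : ∀ {l G H} → arity l ≡ 2 → IsFormula G → IsFormula H → IsFormula (node2 l G H)
node2-isFormula {l} {G} {H} arity≡2 (g , G-guarded) (h , H-guarded) = (tt , len , vs , reach) , guarded
  where
  N = node2 l G H
  module L = Embedded (node2-left l G H)
  module R = Embedded (node2-right l G H)
  len : ∀ v → Vert N v → length (succ N v) ≡ arity (lab N v)
  len v vv with node2-view (size G) (size H) v
  ... | at-root    = sym arity≡2
  ... | in-left i  = L.succ-length⁺ (succ-length g i (L.vert⁻ vv))
  ... | in-right j = R.succ-length⁺ (succ-length h j (R.vert⁻ vv))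
  vs : ∀ v → Vert N v → All (Vert N) (succ N v)
  vs v vv with node2-view (size G) (size H) v
  ... | at-root    = L.vert⁺ (root-isVert g) ∷ R.vert⁺ (root-isVert h) ∷ []
  ... | in-left i  = L.succ-isVert⁺ (succ-isVert g i (L.vert⁻ vv))
  ... | in-right j = R.succ-isVert⁺ (succ-isVert h j (R.vert⁻ vv))
  reach : ∀ v → Vert N v → Reachable N v
  reach v vv with node2-view (size G) (size H) v
  ... | at-root    = _ , here
  ... | in-left i  = L.reachable⁺ (here refl) (reachable g i (L.vert⁻ vv))
  ... | in-right j = R.reachable⁺ (there (here refl)) (reachable h j (R.vert⁻ vv))
  unentered : ∀ u → ¬ Edge N u zero
  unentered u e with node2-view (size G) (size H) u
  unentered .zero (here ())         | at-root
  unentered .zero (there (here ())) | at-root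
  unentered u e | in-left i with L.edge-from-image e
  ... | _ , ()
  unentered u e | in-right j with R.edge-from-image e
  ... | _ , ()
  guarded : Guarded N
  guarded (x ∷ xs) cycle with node2-view (size G) (size H) x
  ... | at-root    = ⊥-elim (unentered-∉-cycle {N} unentered cycle)
  ... | in-left i  = L.guarded-through-image G-guarded i xs cycle
  ... | in-right j = R.guarded-through-image H-guarded j xs cycle

□-isFormula : ∀ {φ} → IsFormula φ → IsFormula (□ φ)
□-isFormula = node1-isFormula refl

∧-isFormula : ∀ {φ ψ} → IsFormula φ → IsFormula ψ → IsFormula (φ ∧ᶠ ψ)
∧-isFormula = node2-isFormula refl

var-isFormula : ∀ p → IsFormula (varᶠ p)
var-isFormula p = leaf-isFormula {var p} refl

⇒-isFormula : ∀ {φ ψ} → IsFormula φ → IsFormula ψ → IsFormula (φ ⇒ ψ)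
⇒-isFormula = node2-isFormula refl

module ϝ-Properties (p : ℕ) {A : Graph} (A-formula : IsFormula A) (root-boxed : Boxed A (root A)) where

  private
    B = ϝ p A
    gA = proj₁ A-formula

  open import Data.List.Membership.DecPropositional (_≟ᶠ_ {size A}) using (_∈?_)

  redirect : Fin (size A) → Fin (size A)
  redirect w = if isVar p (lab A w) then root A else w

  redirect-p : ∀ {w} → isVar p (lab A w) ≡ true → redirect w ≡ root A
  redirect-p {w} = cong (λ b → if b then root A else w)

  redirect-¬p : ∀ {w} → isVar p (lab A w) ≡ false → redirect w ≡ w
  redirect-¬p {w} = cong (λ b → if b then root A else w)

  redirect-cases : ∀ w → redirect w ≡ root A ⊎ redirect w ≡ w
  redirect-cases w with isVar p (lab A w)
  ... | true  = inj₁ refl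
  ... | false = inj₂ refl

  vert⁺ : ∀ {w} → Vert A w → isVar p (lab A w) ≡ false → Vert B w
  vert⁺ vw w-¬p = from T-∧ (vw , from T-not-≡ w-¬p)

  vert⁻ : ∀ {w} → Vert B w → Vert A w × isVar p (lab A w) ≡ false
  vert⁻ vw with to T-∧ vw
  ... | vw′ , w-¬p = vw′ , to T-not-≡ w-¬p

  root-isVertᴮ : Vert B (root A)
  root-isVertᴮ = vert⁺ (root-isVert gA) (cong (isVar p) root-boxed)

  redirect-isVert : ∀ {w} → Vert A w → Vert B (redirect w)
  redirect-isVert {w} vw with isVar p (lab A w) in eq
  ... | true  = root-isVertᴮ
  ... | false = vert⁺ vw eq

  p-sink : ∀ {m x} → Vert A m → isVar p (lab A m) ≡ true → ¬ Edge A m x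
  p-sink {m} vm m-p = length≡0⇒∉ (succ A m) (trans (succ-length gA m vm) (cong arity (isVar⇒≡var _ m-p)))

  -- p-vertices have no successors, so only the last vertex of a walk can be one.
  walk⁺ : ∀ {u v vs} → Vert A u → Walk A u v vs → isVar p (lab A v) ≡ false → Walk B u v vs
  walk⁺ _ here _ = here
  walk⁺ {u} vu (step {v = m} um w) v-¬p with vm ← All.lookup (succ-isVert gA u vu) um | isVar p (lab A m) in m-p
  ... | false = step (subst (_∈ succ B u) (redirect-¬p m-p) (∈-map⁺ redirect um)) (walk⁺ vm w v-¬p)
  ... | true with w
  ...   | step mx _ = ⊥-elim (p-sink vm m-p mx)
  ...   | here with trans (sym m-p) v-¬p
  ...     | ()

  edge⁻ : ∀ {u w} → root A ≢ w → Edge B u w → Edge A u w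
  edge⁻ {u} r≢w uw with ∈-map⁻ redirect uw
  ... | w′ , w′∈ , refl with redirect-cases w′
  ...   | inj₁ eq = ⊥-elim (r≢w (sym eq))
  ...   | inj₂ eq = subst (_∈ succ A u) (sym eq) w′∈

  linked⁻ : ∀ {y ys} → All (root A ≢_) ys → Linked (Edge B) (y ∷ ys) → Linked (Edge A) (y ∷ ys)
  linked⁻ []             [-]         = [-]
  linked⁻ (r≢z ∷ r≢zs) (yz ∷ linked) = edge⁻ r≢z yz ∷ linked⁻ r≢zs linked

  guarded : Guarded B
  guarded (x ∷ xs) (vs , unique , linked) with root A ∈? (x ∷ xs)
  ... | yes r∈ = Any.map (λ { refl → root-boxed }) r∈
  ... | no r∉  = proj₂ A-formula (x ∷ xs)
    (All.map (proj₁ ∘ vert⁻) vs , unique , linked⁻ (AllP.++⁺ (All.tail avoids) (All.head avoids ∷ [])) linked)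
    where
    avoids : All (root A ≢_) (x ∷ xs)
    avoids = AllP.¬Any⇒All¬ (x ∷ xs) r∉

  isFormula : IsFormula B
  isFormula = (root-isVertᴮ , len , vs , reach) , guarded
    where
    len : ∀ v → Vert B v → length (succ B v) ≡ arity (lab B v)
    len v vv = trans (length-map redirect (succ A v)) (succ-length gA v (proj₁ (vert⁻ vv)))
    vs : ∀ v → Vert B v → All (Vert B) (succ B v)
    vs v vv = AllP.map⁺ (All.map redirect-isVert (succ-isVert gA v (proj₁ (vert⁻ vv))))
    reach : ∀ v → Vert B v → Reachable B v
    reach v vv with vA , v-¬p ← vert⁻ vv with reachable gA v vA
    ... | ws , w = ws , walk⁺ (root-isVert gA) w v-¬p

ϝ-isFormula : ∀ p {A} → IsFormula A → Boxed A (root A) → IsFormula (ϝ p A)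
ϝ-isFormula p A-formula root-boxed = ϝ-Properties.isFormula p A-formula root-boxed

□•-isFormula : ∀ p {φ} → IsFormula φ → IsFormula (□•[ p ] φ)
□•-isFormula p φ-formula =
  ϝ-isFormula p (□-isFormula (∧-isFormula φ-formula (var-isFormula p))) refl

module Unfolding (p : ℕ) {φ : Graph} (φ-formula : IsFormula φ) (fresh : Fresh p φ) where

  private
    A = □ (φ ∧ᶠ varᶠ p)
    B = □•[ p ] φ
    U = □ (φ ∧ᶠ B)
    gφ = proj₁ φ-formula
    gB = proj₁ (□•-isFormula p φ-formula)

  open ϝ-Properties p (□-isFormula (∧-isFormula φ-formula (var-isFormula p))) refl
    using (redirect; redirect-p; redirect-¬p; root-isVertᴮ)

  φ-in-A : Embedding φ A
  φ-in-A = node1-embedding □ᴸ _ ∘ᴱ node2-left ∧ᴸ φ (varᶠ p)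

  p-in-A : Embedding (varᶠ p) A
  p-in-A = node1-embedding □ᴸ _ ∘ᴱ node2-right ∧ᴸ φ (varᶠ p)

  φ-in-U : Embedding φ U
  φ-in-U = node1-embedding □ᴸ _ ∘ᴱ node2-left ∧ᴸ φ B

  B-in-U : Embedding B U
  B-in-U = node1-embedding □ᴸ _ ∘ᴱ node2-right ∧ᴸ φ B

  open Embedding using (embed; lab-embed; succ-embed)

  -- The copy of B inside U is folded onto B itself.
  fold : Fin (size U) → Fin (size B)
  fold zero          = zero
  fold (suc zero)    = suc zero
  fold (suc (suc k)) = [ embed φ-in-A , id ]′ (splitAt (size φ) k)

  fold-φ : ∀ i → fold (embed φ-in-U i) ≡ embed φ-in-A i
  fold-φ i = cong [ embed φ-in-A , id ]′ (splitAt-↑ˡ (size φ) i (size B))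

  fold-B : ∀ j → fold (embed B-in-U j) ≡ j
  fold-B j = cong [ embed φ-in-A , id ]′ (splitAt-↑ʳ (size φ) (size B) j)

  Folds : Fin (size B) → Fin (size U) → Set
  Folds a b = fold b ≡ a × Vert U b

  Matches : Fin (size B) → Fin (size U) → Set
  Matches a b = lab B a ≡ lab U b × Pointwise Folds (succ B a) (succ U b)

  redirect-φ : ∀ {w} → Vert φ w → redirect (embed φ-in-A w) ≡ embed φ-in-A w
  redirect-φ {w} vw = redirect-¬p {embed φ-in-A w}
    (subst (λ l → isVar p l ≡ false) (sym (lab-embed φ-in-A w)) (≢var⇒isVar≡false _ (fresh w vw)))

  redirect-leaf : redirect (embed p-in-A zero) ≡ root A
  redirect-leaf = redirect-p {embed p-in-A zero}
    (subst (λ l → isVar p l ≡ true) (sym (lab-embed p-in-A zero)) (isVar-var p))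

  folds-φ : ∀ {w} → Vert φ w → Folds (redirect (embed φ-in-A w)) (embed φ-in-U w)
  folds-φ vw = trans (fold-φ _) (sym (redirect-φ vw)) , Embedded.vert⁺ φ-in-U vw

  folds-B : ∀ {j} → Vert B j → Folds j (embed B-in-U j)
  folds-B vj = fold-B _ , Embedded.vert⁺ B-in-U vj

  succ-B-φ : ∀ i → succ B (embed φ-in-A i) ≡ map (redirect ∘ embed φ-in-A) (succ φ i)
  succ-B-φ i = begin
    map redirect (succ A (embed φ-in-A i))           ≡⟨ cong (map redirect) (succ-embed φ-in-A i) ⟩
    map redirect (map (embed φ-in-A) (succ φ i))     ≡⟨ map-∘ (succ φ i) ⟨
    map (redirect ∘ embed φ-in-A) (succ φ i)         ∎
    where open ≡-Reasoning

  matches-φ : ∀ i → Vert φ i → Matches (embed φ-in-A i) (embed φ-in-U i)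
  matches-φ i vi rewrite succ-B-φ i | succ-embed φ-in-U i =
    trans (lab-embed φ-in-A i) (sym (lab-embed φ-in-U i)) ,
    All⇒Pointwise-map folds-φ (succ-isVert gφ i vi)

  matches-B : ∀ j → Vert B j → Matches j (embed B-in-U j)
  matches-B j vj rewrite succ-embed B-in-U j =
    sym (lab-embed B-in-U j) ,
    subst (λ l → Pointwise Folds l (map (embed B-in-U) (succ B j))) (map-id (succ B j))
      (All⇒Pointwise-map folds-B (succ-isVert gB j vj))

  matches : ∀ b → Vert U b → Matches (fold b) b
  matches zero _ = refl , (refl , tt) ∷ []
  matches (suc v) vb with node2-view (size φ) (size B) v
  ... | at-root =
    refl ,
    folds-φ (root-isVert gφ) ∷
    (trans (fold-B zero) (sym redirect-leaf) , Embedded.vert⁺ B-in-U root-isVertᴮ) ∷ []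
  ... | in-left i  =
    subst (λ a → Matches a (embed φ-in-U i)) (sym (fold-φ i)) (matches-φ i (Embedded.vert⁻ φ-in-U vb))
  ... | in-right j =
    subst (λ a → Matches a (embed B-in-U j)) (sym (fold-B j)) (matches-B j (Embedded.vert⁻ B-in-U vb))

  unfold-≃ : B ≃ U
  unfold-≃ = Folds , (λ { a b (refl , vb) → matches b vb }) , (refl , tt)

□•-unfold : ∀ p {φ} → IsFormula φ → Fresh p φ → (□•[ p ] φ) ≃ (□ (φ ∧ᶠ □•[ p ] φ))
□•-unfold p φ-formula fresh = Unfolding.unfold-≃ p φ-formula fresh

v₀ v₁ v₂ : PForm
v₀ = pvar 0
v₁ = pvar 1
v₂ = pvar 2

⟨_,_,_⟩ : Graph → Graph → Graph → ℕ → Graph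
⟨ φ , ψ , χ ⟩ 0 = φ
⟨ φ , ψ , χ ⟩ 1 = ψ
⟨ φ , ψ , χ ⟩ _ = χ

∧-introᵖ : PForm
∧-introᵖ = v₀ p→ (v₁ p→ (v₀ p∧ v₁))

∧-intro-taut : Tautology ∧-introᵖ
∧-intro-taut ρ with ρ 0 | ρ 1
... | false | _     = refl
... | true  | false = refl
... | true  | true  = refl

⇒-∧-selfᵖ : PForm
⇒-∧-selfᵖ = (v₀ p→ v₁) p→ (v₀ p→ (v₁ p∧ v₀))

⇒-∧-self-taut : Tautology ⇒-∧-selfᵖ
⇒-∧-self-taut ρ with ρ 0 | ρ 1
... | false | _     = refl
... | true  | false = refl
... | true  | true  = refl

⇔-elimʳᵖ : PForm
⇔-elimʳᵖ = ((v₀ p→ v₁) p∧ (v₁ p→ v₀)) p→ (v₁ p→ v₀)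

⇔-elimʳ-taut : Tautology ⇔-elimʳᵖ
⇔-elimʳ-taut ρ with ρ 0 | ρ 1
... | false | false = refl
... | false | true  = refl
... | true  | false = refl
... | true  | true  = refl

⇒-transᵖ : PForm
⇒-transᵖ = (v₀ p→ v₁) p→ ((v₁ p→ v₂) p→ (v₀ p→ v₂))

⇒-trans-taut : Tautology ⇒-transᵖ
⇒-trans-taut ρ with ρ 0 | ρ 1 | ρ 2
... | false | false | _     = refl
... | false | true  | false = refl
... | false | true  | true  = refl
... | true  | false | _     = refl
... | true  | true  | false = refl
... | true  | true  | true  = refl

module _ {φ ψ : Graph} (φ-formula : IsFormula φ) (ψ-formula : IsFormula ψ) where

  ⇔-elimʳ : CHL⊢ φ ⇔ ψ → CHL⊢ ψ ⇒ φ
  ⇔-elimʳ ⊢φ⇔ψ = mp ⊢φ⇔ψ (taut ⇔-elimʳᵖ ⟨ φ , ψ , φ ⟩ ⇔-elimʳ-taut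
    (⇒-isFormula (∧-isFormula (⇒-isFormula φ-formula ψ-formula) (⇒-isFormula ψ-formula φ-formula))
                 (⇒-isFormula ψ-formula φ-formula)))

  □-mono : CHL⊢ □ (φ ⇒ ψ) → CHL⊢ □ φ ⇒ □ ψ
  □-mono ⊢□φ⇒ψ = mp ⊢□φ⇒ψ (K φ-formula ψ-formula)

  ∧-intro : CHL⊢ φ ⇒ (ψ ⇒ φ ∧ᶠ ψ)
  ∧-intro = taut ∧-introᵖ ⟨ φ , ψ , φ ⟩ ∧-intro-taut
    (⇒-isFormula φ-formula (⇒-isFormula ψ-formula (∧-isFormula φ-formula ψ-formula)))

  ⇒-∧-self : CHL⊢ φ ⇒ ψ → CHL⊢ φ ⇒ ψ ∧ᶠ φ
  ⇒-∧-self ⊢φ⇒ψ = mp ⊢φ⇒ψ (taut ⇒-∧-selfᵖ ⟨ φ , ψ , φ ⟩ ⇒-∧-self-taut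
    (⇒-isFormula (⇒-isFormula φ-formula ψ-formula) (⇒-isFormula φ-formula (∧-isFormula ψ-formula φ-formula))))

⇒-trans : ∀ {φ ψ χ} → IsFormula φ → IsFormula ψ → IsFormula χ →
  CHL⊢ φ ⇒ ψ → CHL⊢ ψ ⇒ χ → CHL⊢ φ ⇒ χ
⇒-trans {φ} {ψ} {χ} φ-formula ψ-formula χ-formula ⊢φ⇒ψ ⊢ψ⇒χ =
  mp ⊢ψ⇒χ (mp ⊢φ⇒ψ (taut ⇒-transᵖ ⟨ φ , ψ , χ ⟩ ⇒-trans-taut
    (⇒-isFormula (⇒-isFormula φ-formula ψ-formula)
      (⇒-isFormula (⇒-isFormula ψ-formula χ-formula) (⇒-isFormula φ-formula χ-formula)))))

module _ (p : ℕ) {φ : Graph} (φ-formula : IsFormula φ) (fresh : Fresh p φ) where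

  private
    B = □•[ p ] φ
    B-formula = □•-isFormula p φ-formula
    φ∧B-formula = ∧-isFormula φ-formula B-formula

  □•-fix : CHL⊢ □ (B ⇒ φ ∧ᶠ B) → CHL⊢ B
  □•-fix ⊢□B⇒φ∧B = löb (⇒-trans (□-isFormula B-formula) (□-isFormula φ∧B-formula) B-formula
    (□-mono B-formula φ∧B-formula ⊢□B⇒φ∧B)
    (⇔-elimʳ B-formula (□-isFormula φ∧B-formula)
      (bis B-formula (□-isFormula φ∧B-formula) (□•-unfold p φ-formula fresh))))

  □•-intro : CHL⊢ □ φ → CHL⊢ B
  □•-intro ⊢□φ = □•-fix (mp ⊢□φ (□-mono φ-formula (⇒-isFormula B-formula φ∧B-formula)
    (nec (∧-intro φ-formula B-formula))))

  □•-löb : CHL⊢ B ⇒ φ → CHL⊢ φ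
  □•-löb ⊢B⇒φ = mp (□•-fix (nec (⇒-∧-self B-formula φ-formula ⊢B⇒φ))) ⊢B⇒φ

theorem3p3 : (φ : Graph) → IsFormula φ →
    ((CHL⊢ □ φ) → ∀ (p : ℕ) → Fresh p φ → CHL⊢ □•[ p ] φ) ×
    ((CHL⊢ φ) → ∀ (p : ℕ) → Fresh p φ → CHL⊢ □•[ p ] φ) ×
    (∀ (p : ℕ) → Fresh p φ → (CHL⊢ □•[ p ] φ ⇒ φ) → CHL⊢ φ)
theorem3p3 φ φ-formula =
  (λ ⊢□φ p fresh → □•-intro p φ-formula fresh ⊢□φ) ,
  (λ ⊢φ p fresh → □•-intro p φ-formula fresh (nec ⊢φ)) ,
  (λ p fresh → □•-löb p φ-formula fresh)
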